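{- Let $\mathcal{V}=(\mathcal{G},\mathcal{L},P)$ be an algebraically closed densely valued $\ell$-group. Then $\mathcal{G}$ is not an existentially closed $\ell$-group.
   Context: All $\ell$-groups are abelian lattice-ordered groups. An $\ell$-group $\mathcal{G}$ is existentially closed if for every $\ell$-group $\mathcal{H}$ containing $\mathcal{G}$ as a sub-$\ell$-group, every existential formula in the language $(0,+,-,\wedge,\vee)$ with parameters from $\mathcal{G}$ that holds in $\mathcal{H}$ holds in $\mathcal{G}$. A valued $\ell$-group is a triple $(\mathcal{G},\mathcal{L},P)$ with $\mathcal{G}$ an $\ell$-group, $\mathcal{L}$ a bounded distributive lattice ($\sqcap,\sqcup,\bot,\top,\sqsubseteq$), and $P:\mathcal{G}\to\mathcal{L}$ such that for all $a,b$: $P(a\wedge b)=P(a)\sqcap P(b)$, $P(a\vee b)=P(a)\sqcup P(b)$, $P(0)=\top$, $P(a)\sqcap P(b)\sqsubseteq P(a+b)$, and every element of $\mathcal{L}$ other than $\bot$ is of the form $P(a)$; it is densely valued if moreover $P(a)=\top$ implies $a\geq0$. Valued $\ell$-groups are structures in the two-sorted language $\mathcal{L}_{\mathrm{vlgrp}}$ with a group sort (symbols $0,+,-,\wedge,\vee$), a lattice sort (symbols $\bot,\top,\sqcap,\sqcup$) and a function symbol $P$ between them; $\mathcal{V}\leq\mathcal{W}$ means substructure. A densely valued $\ell$-group $\mathcal{V}$ is algebraically closed if for every densely valued $\ell$-group $\mathcal{W}\geq\mathcal{V}$, every positive existential $\mathcal{L}_{\mathrm{vlgrp}}$-formula $\phi(\bar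 v)$ and every tuple $\bar c$ from $\mathcal{V}$ of matching sorts, $\mathcal{W}\models\phi(\bar c)$ implies $\mathcal{V}\models\phi(\bar c)$. -}

module Defs where

open import Data.Nat using (ℕ)
open import Data.Fin using (Fin)
open import Data.Maybe using (Maybe; just; nothing; maybe)
open import Data.Product using (Σ; ∃; _×_; _,_)
open import Data.Sum using (_⊎_)
open import Data.Empty using (⊥)
open import Data.Unit using (⊤)
open import Relation.Nullary using (¬_)
open import Relation.Binary.PropositionalEquality using (_≡_; _≢_)
open import Function.Definitions using (Injective)
open import Algebra.Core using (Op₁; Op₂)
import Algebra.Structures as AS
import Algebra.Lattice.Structures as ALS
import Algebra.Definitions as AD

record LGroup : Set₁ where
  field
    Carrier   : Set
    𝟘         : Carrier
    _+_       : Op₂ Carrier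
    -_        : Op₁ Carrier
    _∧_       : Op₂ Carrier
    _∨_       : Op₂ Carrier
    isAbelianGroup : AS.IsAbelianGroup _≡_ _+_ 𝟘 -_
    isLattice      : ALS.IsLattice _≡_ _∨_ _∧_
    +-distribˡ-∨   : AD._DistributesOverˡ_ _≡_ _+_ _∨_
    +-distribˡ-∧   : AD._DistributesOverˡ_ _≡_ _+_ _∧_

  infixl 6 _+_
  infixr 7 _∧_
  infixr 6 _∨_

  _≤_ : Carrier → Carrier → Set
  a ≤ b = a ∧ b ≡ a

open LGroup

-- Embedding of ℓ-groups (G is a sub-ℓ-group of H, up to this embedding).
record LGroupEmbedding (G H : LGroup) : Set where
  field
    f        : Carrier G → Carrier H
    injective : Injective _≡_ _≡_ f
    pres-0   : f (𝟘 G) ≡ 𝟘 H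
    pres-+   : ∀ a b → f (_+_ G a b) ≡ _+_ H (f a) (f b)
    pres-−   : ∀ a → f (-_ G a) ≡ -_ H (f a)
    pres-∧   : ∀ a b → f (_∧_ G a b) ≡ _∧_ H (f a) (f b)
    pres-∨   : ∀ a b → f (_∨_ G a b) ≡ _∨_ H (f a) (f b)

data GTerm (X : Set) : Set where
  var  : X → GTerm X
  `0   : GTerm X
  _`+_ : GTerm X → GTerm X → GTerm X
  `-_  : GTerm X → GTerm X
  _`∧_ : GTerm X → GTerm X → GTerm X
  _`∨_ : GTerm X → GTerm X → GTerm X

evalG : (G : LGroup) {X : Set} → (X → Carrier G) → GTerm X → Carrier G
evalG G ρ (var x)  = ρ x
evalG G ρ `0       = 𝟘 G
evalG G ρ (s `+ t) = _+_ G (evalG G ρ s) (evalG G ρ t)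
evalG G ρ (`- t)   = -_ G (evalG G ρ t)
evalG G ρ (s `∧ t) = _∧_ G (evalG G ρ s) (evalG G ρ t)
evalG G ρ (s `∨ t) = _∨_ G (evalG G ρ s) (evalG G ρ t)

data QF (X : Set) : Set where
  _`≈_  : GTerm X → GTerm X → QF X
  `⊤ `⊥ : QF X
  `¬_   : QF X → QF X
  _`&_  : QF X → QF X → QF X
  _`∣_  : QF X → QF X → QF X

data ExF (X : Set) : Set where
  qf  : QF X → ExF X
  `∃_ : ExF (Maybe X) → ExF X

extend : {X A : Set} → (X → A) → A → Maybe X → A
extend ρ a = maybe ρ a

satQF : (G : LGroup) {X : Set} → (X → Carrier G) → QF X → Set
satQF G ρ (s `≈ t) = evalG G ρ s ≡ evalG G ρ t
satQF G ρ `⊤       = ⊤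
satQF G ρ `⊥       = ⊥
satQF G ρ (`¬ φ)   = ¬ satQF G ρ φ
satQF G ρ (φ `& ψ) = satQF G ρ φ × satQF G ρ ψ
satQF G ρ (φ `∣ ψ) = satQF G ρ φ ⊎ satQF G ρ ψ

satEx : (G : LGroup) {X : Set} → (X → Carrier G) → ExF X → Set
satEx G ρ (qf φ)  = satQF G ρ φ
satEx G ρ (`∃ φ)  = Σ (Carrier G) λ a → satEx G (extend ρ a) φ

ExistentiallyClosed : LGroup → Set₁
ExistentiallyClosed G =
  (H : LGroup) (e : LGroupEmbedding G H) {k : ℕ} (φ : ExF (Fin k))
  (c : Fin k → Carrier G) →
  satEx H (λ i → LGroupEmbedding.f e (c i)) φ → satEx G c φ

record BDLattice : Set₁ where
  field
    LCarrier : Set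
    _⊓_     : Op₂ LCarrier
    _⊔_     : Op₂ LCarrier
    ⊥L      : LCarrier
    ⊤L      : LCarrier
    isDistributiveLattice : ALS.IsDistributiveLattice _≡_ _⊔_ _⊓_
    ⊔-identity : AD.Identity _≡_ ⊥L _⊔_
    ⊓-identity : AD.Identity _≡_ ⊤L _⊓_

  _⊑_ : LCarrier → LCarrier → Set
  x ⊑ y = x ⊓ y ≡ x

record ValuedLGroup : Set₁ where
  field
    G : LGroup
    L : BDLattice
    P : Carrier G → BDLattice.LCarrier L
  open BDLattice L
  field
    P-∧ : ∀ a b → P (_∧_ G a b) ≡ P a ⊓ P b
    P-∨ : ∀ a b → P (_∨_ G a b) ≡ P a ⊔ P b
    P-0 : P (𝟘 G) ≡ ⊤L
    P-+ : ∀ a b → (P a ⊓ P b) ⊑ P (_+_ G a b)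
    P-onto : ∀ (x : BDLattice.LCarrier L) → x ≢ ⊥L → ∃ λ a → P a ≡ x

DenselyValued : ValuedLGroup → Set
DenselyValued V =
  ∀ a → P a ≡ BDLattice.⊤L L → _≤_ G (𝟘 G) a
  where open ValuedLGroup V

record VEmbedding (V W : ValuedLGroup) : Set where
  private
    module V = ValuedLGroup V
    module W = ValuedLGroup W
    module LV = BDLattice V.L
    module LW = BDLattice W.L
  field
    g     : LGroupEmbedding V.G W.G
    h     : LV.LCarrier → LW.LCarrier
    h-injective : Injective _≡_ _≡_ h
    pres-⊥ : h LV.⊥L ≡ LW.⊥L
    pres-⊤ : h LV.⊤L ≡ LW.⊤L
    pres-⊓ : ∀ x y → h (x LV.⊓ y) ≡ h x LW.⊓ h y
    pres-⊔ : ∀ x y → h (x LV.⊔ y) ≡ h x LW.⊔ h y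
    pres-P : ∀ a → h (V.P a) ≡ W.P (LGroupEmbedding.f g a)

data LTerm (X Y : Set) : Set where
  lvar : Y → LTerm X Y
  `⊥L  : LTerm X Y
  `⊤L  : LTerm X Y
  _`⊓_ : LTerm X Y → LTerm X Y → LTerm X Y
  _`⊔_ : LTerm X Y → LTerm X Y → LTerm X Y
  `P   : GTerm X → LTerm X Y

evalL : (V : ValuedLGroup) {X Y : Set} →
        (X → Carrier (ValuedLGroup.G V)) →
        (Y → BDLattice.LCarrier (ValuedLGroup.L V)) →
        LTerm X Y → BDLattice.LCarrier (ValuedLGroup.L V)
evalL V ρ σ (lvar y)  = σ y
evalL V ρ σ `⊥L       = BDLattice.⊥L (ValuedLGroup.L V)
evalL V ρ σ `⊤L       = BDLattice.⊤L (ValuedLGroup.L V)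
evalL V ρ σ (s `⊓ t)  = BDLattice._⊓_ (ValuedLGroup.L V) (evalL V ρ σ s) (evalL V ρ σ t)
evalL V ρ σ (s `⊔ t)  = BDLattice._⊔_ (ValuedLGroup.L V) (evalL V ρ σ s) (evalL V ρ σ t)
evalL V ρ σ (`P t)    = ValuedLGroup.P V (evalG (ValuedLGroup.G V) ρ t)

data PosEx (X Y : Set) : Set where
  _`≈G_ : GTerm X → GTerm X → PosEx X Y
  _`≈L_ : LTerm X Y → LTerm X Y → PosEx X Y
  _`&_  : PosEx X Y → PosEx X Y → PosEx X Y
  _`∣_  : PosEx X Y → PosEx X Y → PosEx X Y
  `∃G_  : PosEx (Maybe X) Y → PosEx X Y
  `∃L_  : PosEx X (Maybe Y) → PosEx X Y

satPE : (V : ValuedLGroup) {X Y : Set} →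
        (X → Carrier (ValuedLGroup.G V)) →
        (Y → BDLattice.LCarrier (ValuedLGroup.L V)) →
        PosEx X Y → Set
satPE V ρ σ (s `≈G t) = evalG (ValuedLGroup.G V) ρ s ≡ evalG (ValuedLGroup.G V) ρ t
satPE V ρ σ (s `≈L t) = evalL V ρ σ s ≡ evalL V ρ σ t
satPE V ρ σ (φ `& ψ)  = satPE V ρ σ φ × satPE V ρ σ ψ
satPE V ρ σ (φ `∣ ψ)  = satPE V ρ σ φ ⊎ satPE V ρ σ ψ
satPE V ρ σ (`∃G φ)   = Σ (Carrier (ValuedLGroup.G V)) λ a → satPE V (extend ρ a) σ φ
satPE V ρ σ (`∃L φ)   = Σ (BDLattice.LCarrier (ValuedLGroup.L V)) λ x → satPE V ρ (extend σ x) φ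

AlgebraicallyClosed : ValuedLGroup → Set₁
AlgebraicallyClosed V =
  (W : ValuedLGroup) → DenselyValued W → (e : VEmbedding V W) →
  {k m : ℕ} (φ : PosEx (Fin k) (Fin m)) →
  (c : Fin k → Carrier (ValuedLGroup.G V)) →
  (d : Fin m → BDLattice.LCarrier (ValuedLGroup.L V)) →
  satPE W (λ i → LGroupEmbedding.f (VEmbedding.g e) (c i))
          (λ j → VEmbedding.h e (d j)) φ →
  satPE V c d φ

-- If P b = ⊥ for some b, then in G every x with x ∨ (b ∧ 0) = 0 is 0: the value of x is
-- P x ⊔ ⊥ = P 0 = ⊤, so x ≥ 0 by density, while x ≤ x ∨ (b ∧ 0) = 0. In G × ℤ, however,
-- (0, −1) is a nonzero such x, so G is not existentially closed.
-- The value ⊥ is attained: at 0 if ⊥ = ⊤, and otherwise V embeds into the densely valued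
-- lexicographic product ℤ ×lex G, valued by ⊥ below level 0, by P on level 0 and by ⊤
-- above it, where (−1, 0) has value ⊥; algebraic closedness pulls such an element into V.
module Submission where

open import Defs
open import Relation.Nullary using (¬_)

open import Level using (0ℓ)
open import Data.Nat using (z<s)
open import Data.Fin using (Fin; zero)
open import Data.Maybe using (Maybe; just; nothing)
open import Data.Product using (∃; _×_; _,_; proj₁; proj₂; map; zip′)
open import Data.Empty using (⊥-elim)
open import Data.Integer using (ℤ; +_; +0; +[1+_]; -[1+_]; +<+)
import Data.Integer as ℤ
import Data.Integer.Properties as ℤ
open import Function using (case_of_)
open import Relation.Binary.PropositionalEquality
  using (_≡_; _≢_; refl; sym; trans; cong; cong₂; isEquivalence; module ≡-Reasoning)
open import Relation.Binary.Core using (Rel)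
open import Relation.Binary.Definitions using (Tri; tri<; tri≈; tri>)
open import Relation.Binary.Structures using (IsStrictTotalOrder)
import Relation.Binary.Construct.Flip.EqAndOrd as Flip
open import Algebra.Core using (Op₁; Op₂)
open import Algebra.Definitions using (_DistributesOverˡ_)
open import Algebra.Structures using (IsAbelianGroup)
open import Algebra.Bundles using (Group)
open import Algebra.Lattice.Structures using (IsLattice; IsSemilattice; IsDistributiveLattice)
open import Algebra.Lattice.Bundles using (Lattice)
import Algebra.Lattice.Properties.Lattice as LatticeProperties
import Algebra.Properties.Group as GroupProperties

×-isAbelianGroup : {A B : Set} {_+ᴬ_ : Op₂ A} {0ᴬ : A} {negᴬ : Op₁ A}
                   {_+ᴮ_ : Op₂ B} {0ᴮ : B} {negᴮ : Op₁ B} →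
                   IsAbelianGroup _≡_ _+ᴬ_ 0ᴬ negᴬ → IsAbelianGroup _≡_ _+ᴮ_ 0ᴮ negᴮ →
                   IsAbelianGroup _≡_ (zip′ _+ᴬ_ _+ᴮ_) (0ᴬ , 0ᴮ) (map negᴬ negᴮ)
×-isAbelianGroup {negᴬ = negᴬ} {negᴮ = negᴮ} A B = record
  { isGroup = record
    { isMonoid = record
      { isSemigroup = record
        { isMagma = record { isEquivalence = isEquivalence ; ∙-cong = cong₂ _ }
        ; assoc = λ _ _ _ → cong₂ _,_ (A.assoc _ _ _) (B.assoc _ _ _) }
      ; identity = (λ _ → cong₂ _,_ (A.identityˡ _) (B.identityˡ _))
                 , (λ _ → cong₂ _,_ (A.identityʳ _) (B.identityʳ _)) }
    ; inverse = (λ _ → cong₂ _,_ (A.inverseˡ _) (B.inverseˡ _))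
              , (λ _ → cong₂ _,_ (A.inverseʳ _) (B.inverseʳ _))
    ; ⁻¹-cong = cong (map negᴬ negᴮ) }
  ; comm = λ _ _ → cong₂ _,_ (A.comm _ _) (B.comm _ _) }
  where
  module A = IsAbelianGroup A
  module B = IsAbelianGroup B

×-isLattice : {A B : Set} {_∨ᴬ_ _∧ᴬ_ : Op₂ A} {_∨ᴮ_ _∧ᴮ_ : Op₂ B} →
              IsLattice _≡_ _∨ᴬ_ _∧ᴬ_ → IsLattice _≡_ _∨ᴮ_ _∧ᴮ_ →
              IsLattice _≡_ (zip′ _∨ᴬ_ _∨ᴮ_) (zip′ _∧ᴬ_ _∧ᴮ_)
×-isLattice A B = record
  { isEquivalence = isEquivalence
  ; ∨-comm = λ _ _ → cong₂ _,_ (A.∨-comm _ _) (B.∨-comm _ _)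
  ; ∨-assoc = λ _ _ _ → cong₂ _,_ (A.∨-assoc _ _ _) (B.∨-assoc _ _ _)
  ; ∨-cong = cong₂ _
  ; ∧-comm = λ _ _ → cong₂ _,_ (A.∧-comm _ _) (B.∧-comm _ _)
  ; ∧-assoc = λ _ _ _ → cong₂ _,_ (A.∧-assoc _ _ _) (B.∧-assoc _ _ _)
  ; ∧-cong = cong₂ _
  ; absorptive = (λ _ _ → cong₂ _,_ (proj₁ A.absorptive _ _) (proj₁ B.absorptive _ _))
               , (λ _ _ → cong₂ _,_ (proj₂ A.absorptive _ _) (proj₂ B.absorptive _ _)) }
  where
  module A = IsLattice A
  module B = IsLattice B

module LGroupProperties (G : LGroup) where
  open LGroup G public
  open IsAbelianGroup isAbelianGroup public using (identityˡ)
  open IsLattice isLattice public using (∧-comm; absorptive)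

  lattice : Lattice 0ℓ 0ℓ
  lattice = record { isLattice = isLattice }

  open LatticeProperties lattice public using (∧-idem; ∨-idem; ∧-isSemilattice; ∨-isSemilattice)

  group : Group 0ℓ 0ℓ
  group = record { isGroup = IsAbelianGroup.isGroup isAbelianGroup }

  open GroupProperties group public using (ε⁻¹≈ε)

  ≤-antisym : ∀ {x y} → x ≤ y → y ≤ x → x ≡ y
  ≤-antisym {x} {y} x≤y y≤x = trans (sym x≤y) (trans (∧-comm x y) y≤x)

  x≤x∨y : ∀ x y → x ≤ (x ∨ y)
  x≤x∨y x y = proj₂ absorptive x y

module BDLatticeProperties (L : BDLattice) where
  open BDLattice L public

  lattice : Lattice 0ℓ 0ℓ
  lattice = record { isLattice = IsDistributiveLattice.isLattice isDistributiveLattice }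

  open Lattice lattice public using () renaming (∧-comm to ⊓-comm; ∨-comm to ⊔-comm; absorptive to ⊔-⊓-absorptive)
  open LatticeProperties lattice public using () renaming (∧-idem to ⊓-idem; ∨-idem to ⊔-idem)

  ⊓-identityʳ : ∀ x → x ⊓ ⊤L ≡ x
  ⊓-identityʳ = proj₂ ⊓-identity

  ⊔-identityʳ : ∀ x → x ⊔ ⊥L ≡ x
  ⊔-identityʳ = proj₂ ⊔-identity

  ⊓-zeroˡ : ∀ x → ⊥L ⊓ x ≡ ⊥L
  ⊓-zeroˡ x = trans (cong (⊥L ⊓_) (sym (proj₁ ⊔-identity x))) (proj₂ ⊔-⊓-absorptive ⊥L x)

  ⊓-zeroʳ : ∀ x → x ⊓ ⊥L ≡ ⊥L
  ⊓-zeroʳ x = trans (⊓-comm x ⊥L) (⊓-zeroˡ x)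

  ⊑⇒⊔≡ : ∀ {x y} → x ⊑ y → x ⊔ y ≡ y
  ⊑⇒⊔≡ {x} {y} x⊓y≡x = begin
    x ⊔ y        ≡⟨ cong (_⊔ y) (sym x⊓y≡x) ⟩
    (x ⊓ y) ⊔ y  ≡⟨ ⊔-comm (x ⊓ y) y ⟩
    y ⊔ (x ⊓ y)  ≡⟨ cong (y ⊔_) (⊓-comm x y) ⟩
    y ⊔ (y ⊓ x)  ≡⟨ proj₁ ⊔-⊓-absorptive y x ⟩
    y            ∎
    where open ≡-Reasoning

infixr 2 _×ᴸ_

_×ᴸ_ : LGroup → LGroup → LGroup
G ×ᴸ K = record
  { Carrier = G.Carrier × K.Carrier
  ; 𝟘 = G.𝟘 , K.𝟘
  ; _+_ = zip′ G._+_ K._+_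
  ; -_ = map G.-_ K.-_
  ; _∧_ = zip′ G._∧_ K._∧_
  ; _∨_ = zip′ G._∨_ K._∨_
  ; isAbelianGroup = ×-isAbelianGroup G.isAbelianGroup K.isAbelianGroup
  ; isLattice = ×-isLattice G.isLattice K.isLattice
  ; +-distribˡ-∨ = λ _ _ _ → cong₂ _,_ (G.+-distribˡ-∨ _ _ _) (K.+-distribˡ-∨ _ _ _)
  ; +-distribˡ-∧ = λ _ _ _ → cong₂ _,_ (G.+-distribˡ-∧ _ _ _) (K.+-distribˡ-∧ _ _ _)
  }
  where
  module G = LGroup G
  module K = LGroup K

×ᴸ-inj₁ : (G K : LGroup) → LGroupEmbedding G (G ×ᴸ K)
×ᴸ-inj₁ G K = record
  { f = λ a → a , K.𝟘
  ; injective = cong proj₁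
  ; pres-0 = refl
  ; pres-+ = λ a b → cong (G._+_ a b ,_) (sym (K.identityˡ K.𝟘))
  ; pres-− = λ a → cong (G.-_ a ,_) (sym K.ε⁻¹≈ε)
  ; pres-∧ = λ a b → cong (G._∧_ a b ,_) (sym (K.∧-idem K.𝟘))
  ; pres-∨ = λ a b → cong (G._∨_ a b ,_) (sym (K.∨-idem K.𝟘))
  }
  where
  module G = LGroup G
  module K = LGroupProperties K

ℤᴸ : LGroup
ℤᴸ = record
  { Carrier = ℤ
  ; 𝟘 = +0
  ; _+_ = ℤ._+_
  ; -_ = ℤ.-_
  ; _∧_ = ℤ._⊓_
  ; _∨_ = ℤ._⊔_
  ; isAbelianGroup = ℤ.+-0-isAbelianGroup
  ; isLattice = ℤ.⊔-⊓-isLattice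
  ; +-distribˡ-∨ = λ i → ℤ.mono-≤-distrib-⊔ (ℤ.+-monoʳ-≤ i)
  ; +-distribˡ-∧ = λ i → ℤ.mono-≤-distrib-⊓ (ℤ.+-monoʳ-≤ i)
  }

module Lex {T C : Set} {_<_ : Rel T 0ℓ} (<-isStrictTotalOrder : IsStrictTotalOrder _≡_ _<_)
           {_·_ : Op₂ C} (·-isSemilattice : IsSemilattice _≡_ _·_) where
  open IsStrictTotalOrder <-isStrictTotalOrder using (compare; irrefl; asym)
    renaming (trans to <-trans)
  private module S = IsSemilattice _≡_ ·-isSemilattice

  lex : Op₂ (T × C)
  lex (n , a) (m , b) with compare n m
  ... | tri< _ _ _ = n , a
  ... | tri≈ _ _ _ = n , a · b
  ... | tri> _ _ _ = m , b

  lex-< : ∀ {n m a b} → n < m → lex (n , a) (m , b) ≡ (n , a)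
  lex-< {n} {m} n<m with compare n m
  ... | tri< _ _ _    = refl
  ... | tri≈ _ refl _ = ⊥-elim (irrefl refl n<m)
  ... | tri> _ _ m<n  = ⊥-elim (asym n<m m<n)

  lex-> : ∀ {n m a b} → m < n → lex (n , a) (m , b) ≡ (m , b)
  lex-> {n} {m} m<n with compare n m
  ... | tri< n<m _ _  = ⊥-elim (asym n<m m<n)
  ... | tri≈ _ refl _ = ⊥-elim (irrefl refl m<n)
  ... | tri> _ _ _    = refl

  lex-≡ : ∀ {n a b} → lex (n , a) (n , b) ≡ (n , a · b)
  lex-≡ {n} with compare n n
  ... | tri< n<n _ _ = ⊥-elim (irrefl refl n<n)
  ... | tri≈ _ _ _   = refl
  ... | tri> _ _ n<n = ⊥-elim (irrefl refl n<n)

  lex-idem : ∀ x → lex x x ≡ x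
  lex-idem (n , a) = trans lex-≡ (cong (n ,_) (S.idem a))

  lex-comm : ∀ x y → lex x y ≡ lex y x
  lex-comm (n , a) (m , b) = case compare n m of λ where
    (tri< n<m _ _)  → trans (lex-< n<m) (sym (lex-> n<m))
    (tri≈ _ refl _) → trans lex-≡ (trans (cong (n ,_) (S.comm a b)) (sym lex-≡))
    (tri> _ _ m<n)  → trans (lex-> m<n) (sym (lex-< m<n))

  lex-assoc : ∀ x y z → lex (lex x y) z ≡ lex x (lex y z)
  lex-assoc (n , a) (m , b) (k , c) = case compare n m , compare m k of λ where
    (tri< n<m _ _ , tri< m<k _ _) →
      trans (cong (λ x → lex x (k , c)) (lex-< n<m))
            (trans (lex-< (<-trans n<m m<k)) (sym (trans (cong (lex (n , a)) (lex-< m<k)) (lex-< n<m))))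
    (tri< n<m _ _ , tri≈ _ refl _) →
      trans (cong (λ x → lex x (m , c)) (lex-< n<m))
            (trans (lex-< n<m) (sym (trans (cong (lex (n , a)) lex-≡) (lex-< n<m))))
    (tri< n<m _ _ , tri> _ _ k<m) →
      trans (cong (λ x → lex x (k , c)) (lex-< n<m)) (sym (cong (lex (n , a)) (lex-> k<m)))
    (tri≈ _ refl _ , _) →
      trans (cong (λ x → lex x (k , c)) lex-≡) (equal-heads (compare n k))
    (tri> _ _ m<n , tri< m<k _ _) →
      trans (cong (λ x → lex x (k , c)) (lex-> m<n))
            (trans (lex-< m<k) (sym (trans (cong (lex (n , a)) (lex-< m<k)) (lex-> m<n))))
    (tri> _ _ m<n , tri≈ _ refl _) →
      trans (cong (λ x → lex x (m , c)) (lex-> m<n))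
            (trans lex-≡ (sym (trans (cong (lex (n , a)) lex-≡) (lex-> m<n))))
    (tri> _ _ m<n , tri> _ _ k<m) →
      trans (cong (λ x → lex x (k , c)) (lex-> m<n))
            (trans (lex-> k<m) (sym (trans (cong (lex (n , a)) (lex-> k<m)) (lex-> (<-trans k<m m<n)))))
   where
    equal-heads : Tri (n < k) (n ≡ k) (k < n) → lex (n , a · b) (k , c) ≡ lex (n , a) (lex (n , b) (k , c))
    equal-heads (tri< n<k _ _) =
      trans (lex-< n<k) (sym (trans (cong (lex (n , a)) (lex-< n<k)) lex-≡))
    equal-heads (tri≈ _ refl _) =
      trans lex-≡ (trans (cong (n ,_) (S.assoc a b c)) (sym (trans (cong (lex (n , a)) lex-≡) lex-≡)))
    equal-heads (tri> _ _ k<n) =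
      trans (lex-> k<n) (sym (trans (cong (lex (n , a)) (lex-> k<n)) (lex-> k<n)))

  lex-translate : {_+_ : Op₂ T} {_⊞_ : Op₂ C} →
                  (∀ n {m k} → m < k → (n + m) < (n + k)) → _DistributesOverˡ_ _≡_ _⊞_ _·_ →
                  ∀ x y z → zip′ _+_ _⊞_ x (lex y z) ≡ lex (zip′ _+_ _⊞_ x y) (zip′ _+_ _⊞_ x z)
  lex-translate {_+_} {_⊞_} +-monoʳ-< ⊞-distribˡ-· (n , a) (m , b) (k , c) = case compare m k of λ where
    (tri< m<k _ _)  → trans (cong (zip′ _+_ _⊞_ (n , a)) (lex-< m<k)) (sym (lex-< (+-monoʳ-< n m<k)))
    (tri≈ _ refl _) → trans (cong (zip′ _+_ _⊞_ (n , a)) lex-≡)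
                        (trans (cong (n + m ,_) (⊞-distribˡ-· a b c)) (sym lex-≡))
    (tri> _ _ k<m)  → trans (cong (zip′ _+_ _⊞_ (n , a)) (lex-> k<m)) (sym (lex-> (+-monoʳ-< n k<m)))

module LexLGroup (G : LGroup) where
  private module G = LGroupProperties G

  module ∧ˡ = Lex ℤ.<-isStrictTotalOrder G.∧-isSemilattice
  module ∨ˡ = Lex (Flip.isStrictTotalOrder ℤ.<-isStrictTotalOrder) G.∨-isSemilattice

  ∨ˡ-absorbs-∧ˡ : ∀ x y → ∨ˡ.lex x (∧ˡ.lex x y) ≡ x
  ∨ˡ-absorbs-∧ˡ (n , a) (m , b) = case ℤ.<-cmp n m of λ where
    (tri< n<m _ _)  → trans (cong (∨ˡ.lex (n , a)) (∧ˡ.lex-< n<m)) (∨ˡ.lex-idem _)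
    (tri≈ _ refl _) →
      trans (cong (∨ˡ.lex (n , a)) ∧ˡ.lex-≡) (trans ∨ˡ.lex-≡ (cong (n ,_) (proj₁ G.absorptive a b)))
    (tri> _ _ m<n)  → trans (cong (∨ˡ.lex (n , a)) (∧ˡ.lex-> m<n)) (∨ˡ.lex-< m<n)

  ∧ˡ-absorbs-∨ˡ : ∀ x y → ∧ˡ.lex x (∨ˡ.lex x y) ≡ x
  ∧ˡ-absorbs-∨ˡ (n , a) (m , b) = case ℤ.<-cmp n m of λ where
    (tri< n<m _ _)  → trans (cong (∧ˡ.lex (n , a)) (∨ˡ.lex-> n<m)) (∧ˡ.lex-< n<m)
    (tri≈ _ refl _) →
      trans (cong (∧ˡ.lex (n , a)) ∨ˡ.lex-≡) (trans ∧ˡ.lex-≡ (cong (n ,_) (proj₂ G.absorptive a b)))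
    (tri> _ _ m<n)  → trans (cong (∧ˡ.lex (n , a)) (∨ˡ.lex-< m<n)) (∧ˡ.lex-idem _)

  ℤ×lex : LGroup
  ℤ×lex = record
    { Carrier = ℤ × G.Carrier
    ; 𝟘 = +0 , G.𝟘
    ; _+_ = zip′ ℤ._+_ G._+_
    ; -_ = map ℤ.-_ G.-_
    ; _∧_ = ∧ˡ.lex
    ; _∨_ = ∨ˡ.lex
    ; isAbelianGroup = ×-isAbelianGroup ℤ.+-0-isAbelianGroup G.isAbelianGroup
    ; isLattice = record
      { isEquivalence = isEquivalence
      ; ∨-comm = ∨ˡ.lex-comm
      ; ∨-assoc = ∨ˡ.lex-assoc
      ; ∨-cong = cong₂ ∨ˡ.lex
      ; ∧-comm = ∧ˡ.lex-comm
      ; ∧-assoc = ∧ˡ.lex-assoc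
      ; ∧-cong = cong₂ ∧ˡ.lex
      ; absorptive = ∨ˡ-absorbs-∧ˡ , ∧ˡ-absorbs-∨ˡ
      }
    ; +-distribˡ-∨ = ∨ˡ.lex-translate (λ n → ℤ.+-monoʳ-< n) G.+-distribˡ-∨
    ; +-distribˡ-∧ = ∧ˡ.lex-translate ℤ.+-monoʳ-< G.+-distribˡ-∧
    }

module _ (V : ValuedLGroup) where
  open ValuedLGroup V
  open BDLatticeProperties L
  private module G = LGroupProperties G
  open LexLGroup G

  P̂ : ℤ × G.Carrier → LCarrier
  P̂ (+0 , a)       = P a
  P̂ (+[1+ _ ] , _) = ⊤L
  P̂ (-[1+ _ ] , _) = ⊥L

  P̂-mono : ∀ {n m a b} → n ℤ.< m → P̂ (n , a) ⊓ P̂ (m , b) ≡ P̂ (n , a)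
  P̂-mono { -[1+ _ ]}            _          = ⊓-zeroˡ _
  P̂-mono {+0}       {+[1+ _ ]}  _          = ⊓-identityʳ _
  P̂-mono {+[1+ _ ]} {+[1+ _ ]}  _          = ⊓-idem ⊤L
  P̂-mono {+0}       {+0}        (+<+ ())
  P̂-mono {+[1+ _ ]} {+0}        (+<+ ())
  P̂-mono {+ _}      { -[1+ _ ]} ()

  P̂-level-∧ : ∀ n a b → P̂ (n , a G.∧ b) ≡ P̂ (n , a) ⊓ P̂ (n , b)
  P̂-level-∧ +0       a b = P-∧ a b
  P̂-level-∧ +[1+ _ ] a b = sym (⊓-idem ⊤L)
  P̂-level-∧ -[1+ _ ] a b = sym (⊓-idem ⊥L)

  P̂-level-∨ : ∀ n a b → P̂ (n , a G.∨ b) ≡ P̂ (n , a) ⊔ P̂ (n , b)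
  P̂-level-∨ +0       a b = P-∨ a b
  P̂-level-∨ +[1+ _ ] a b = sym (⊔-idem ⊤L)
  P̂-level-∨ -[1+ _ ] a b = sym (⊔-idem ⊥L)

  P̂-∧ : ∀ x y → P̂ (∧ˡ.lex x y) ≡ P̂ x ⊓ P̂ y
  P̂-∧ (n , a) (m , b) = case ℤ.<-cmp n m of λ where
    (tri< n<m _ _)  → trans (cong P̂ (∧ˡ.lex-< n<m)) (sym (P̂-mono n<m))
    (tri≈ _ refl _) → trans (cong P̂ (∧ˡ.lex-≡ {n} {a} {b})) (P̂-level-∧ n a b)
    (tri> _ _ m<n)  → trans (cong P̂ (∧ˡ.lex-> m<n)) (sym (trans (⊓-comm _ _) (P̂-mono m<n)))

  P̂-∨ : ∀ x y → P̂ (∨ˡ.lex x y) ≡ P̂ x ⊔ P̂ y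
  P̂-∨ (n , a) (m , b) = case ℤ.<-cmp n m of λ where
    (tri< n<m _ _)  → trans (cong P̂ (∨ˡ.lex-> n<m)) (sym (⊑⇒⊔≡ (P̂-mono n<m)))
    (tri≈ _ refl _) → trans (cong P̂ (∨ˡ.lex-≡ {n} {a} {b})) (P̂-level-∨ n a b)
    (tri> _ _ m<n)  → trans (cong P̂ (∨ˡ.lex-< m<n)) (sym (trans (⊔-comm _ _) (⊑⇒⊔≡ (P̂-mono m<n))))

  P̂-+ : ∀ x y → (P̂ x ⊓ P̂ y) ⊑ P̂ (zip′ ℤ._+_ G._+_ x y)
  P̂-+ (-[1+ _ ] , _) (m , b) rewrite ⊓-zeroˡ (P̂ (m , b)) = ⊓-zeroˡ _
  P̂-+ (+ n , a) (-[1+ _ ] , _) rewrite ⊓-zeroʳ (P̂ (+ n , a)) = ⊓-zeroˡ _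
  P̂-+ (+0 , a)       (+0 , b)       = P-+ a b
  P̂-+ (+0 , a)       (+[1+ _ ] , _) = ⊓-identityʳ _
  P̂-+ (+[1+ _ ] , _) (+ _ , _)      = ⊓-identityʳ _

  lexExtension : ValuedLGroup
  lexExtension = record
    { G = ℤ×lex
    ; L = L
    ; P = P̂
    ; P-∧ = P̂-∧
    ; P-∨ = P̂-∨
    ; P-0 = P-0
    ; P-+ = P̂-+
    ; P-onto = λ x x≢⊥ → let a , Pa≡x = P-onto x x≢⊥ in (+0 , a) , Pa≡x
    }

  lexExtension-dense : DenselyValued V → ⊥L ≢ ⊤L → DenselyValued lexExtension
  lexExtension-dense dense _   (+0 , a)       Pa≡⊤ = trans ∧ˡ.lex-≡ (cong (+0 ,_) (dense a Pa≡⊤))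
  lexExtension-dense _     _   (+[1+ n ] , a) _    = ∧ˡ.lex-< {a = G.𝟘} {b = a} (+<+ (z<s {n}))
  lexExtension-dense _     ⊥≢⊤ (-[1+ _ ] , _) ⊥≡⊤  = ⊥-elim (⊥≢⊤ ⊥≡⊤)

  ≤lexExtension : VEmbedding V lexExtension
  ≤lexExtension = record
    { g = record
      { f = +0 ,_
      ; injective = cong proj₂
      ; pres-0 = refl
      ; pres-+ = λ _ _ → refl
      ; pres-− = λ _ → refl
      ; pres-∧ = λ _ _ → sym ∧ˡ.lex-≡
      ; pres-∨ = λ _ _ → sym ∨ˡ.lex-≡
      }
    ; h = λ x → x
    ; h-injective = λ x≡y → x≡y
    ; pres-⊥ = refl
    ; pres-⊤ = refl
    ; pres-⊓ = λ _ _ → refl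
    ; pres-⊔ = λ _ _ → refl
    ; pres-P = λ _ → refl
    }

  bottom-attained : DenselyValued V → AlgebraicallyClosed V → ⊥L ≢ ⊤L → ∃ λ b → P b ≡ ⊥L
  bottom-attained dense ac ⊥≢⊤ =
    ac lexExtension (lexExtension-dense dense ⊥≢⊤) ≤lexExtension {0} {0}
       (`∃G (`P (var nothing) `≈L `⊥L)) (λ ()) (λ ()) ((-[1+ 0 ] , G.𝟘) , refl)

  x∨c≡𝟘⇒x≡𝟘 : DenselyValued V → ∀ {x c} → P c ≡ ⊥L → x G.∨ c ≡ G.𝟘 → x ≡ G.𝟘
  x∨c≡𝟘⇒x≡𝟘 dense {x} {c} Pc≡⊥ x∨c≡𝟘 =
    G.≤-antisym (trans (cong (x G.∧_) (sym x∨c≡𝟘)) (G.x≤x∨y x c)) (dense x Px≡⊤)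
    where
    Px≡⊤ : P x ≡ ⊤L
    Px≡⊤ = begin
      P x          ≡⟨ sym (⊔-identityʳ (P x)) ⟩
      P x ⊔ ⊥L     ≡⟨ cong (P x ⊔_) (sym Pc≡⊥) ⟩
      P x ⊔ P c    ≡⟨ sym (P-∨ x c) ⟩
      P (x G.∨ c)  ≡⟨ cong P x∨c≡𝟘 ⟩
      P G.𝟘        ≡⟨ P-0 ⟩
      ⊤L           ∎
      where open ≡-Reasoning

  ∃x≢𝟘-x∨b∧𝟘≡𝟘 : ExF (Fin 1)
  ∃x≢𝟘-x∨b∧𝟘≡𝟘 = `∃ qf ((`¬ (x `≈ `0)) `& ((x `∨ (b `∧ `0)) `≈ `0))
    where
    x b : GTerm (Maybe (Fin 1))
    x = var nothing
    b = var (just zero)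

  bottom-attained⇒¬ExistentiallyClosed : DenselyValued V → ∀ {b} → P b ≡ ⊥L → ¬ ExistentiallyClosed G
  bottom-attained⇒¬ExistentiallyClosed dense {b} Pb≡⊥ ec =
    let x , x≢𝟘 , x∨b∧𝟘≡𝟘 = ec (G ×ᴸ ℤᴸ) (×ᴸ-inj₁ G ℤᴸ) ∃x≢𝟘-x∨b∧𝟘≡𝟘 (λ _ → b) witness
    in x≢𝟘 (x∨c≡𝟘⇒x≡𝟘 dense Pb∧𝟘≡⊥ x∨b∧𝟘≡𝟘)
    where
    witness : satEx (G ×ᴸ ℤᴸ) (λ _ → b , +0) ∃x≢𝟘-x∨b∧𝟘≡𝟘
    witness = (G.𝟘 , -[1+ 0 ]) , (λ ()) ,
              cong (_, +0) (trans (cong (G.𝟘 G.∨_) (G.∧-comm b G.𝟘)) (proj₁ G.absorptive G.𝟘 b))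

    Pb∧𝟘≡⊥ : P (b G.∧ G.𝟘) ≡ ⊥L
    Pb∧𝟘≡⊥ = trans (P-∧ b G.𝟘) (trans (cong (_⊓ P G.𝟘) Pb≡⊥) (⊓-zeroˡ _))

mainTheorem8 : (V : ValuedLGroup) → DenselyValued V → AlgebraicallyClosed V →
               ¬ ExistentiallyClosed (ValuedLGroup.G V)
mainTheorem8 V dense ac ec = P≢⊥ (proj₂ (bottom-attained V dense ac ⊥≢⊤))
  where
  open ValuedLGroup V
  open BDLattice L

  P≢⊥ : ∀ {b} → P b ≢ ⊥L
  P≢⊥ Pb≡⊥ = bottom-attained⇒¬ExistentiallyClosed V dense Pb≡⊥ ec

  ⊥≢⊤ : ⊥L ≢ ⊤L
  ⊥≢⊤ ⊥≡⊤ = P≢⊥ (trans P-0 (sym ⊥≡⊤))
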